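{- Let $k$ be an odd positive integer, $d=(k-1)/2$, $1\le i<k$, $V_1=\{1,\ldots,i\}$ and $V_2=\{i+1,\ldots,k\}$. Let ${\bf d}=(d_1,\ldots,d_i)$ be an integer vector with $0\le d_j\le i-1$ for all $j$ and $\sum_j d_j$ even, and let $\mathcal{B}({\bf d}^*)$ be the set of bipartite graphs $B$ with bipartition $(V_1,V_2)$ in which each vertex $j\in V_1$ has degree $d-d_j$; assume $\mathcal{B}({\bf d}^*)\neq\emptyset$. Let $\bar d=(k-i)^{ -1}\sum_{j=1}^i (d-d_j)$. If $B$ is chosen uniformly at random from $\mathcal{B}({\bf d}^*)$, then $$\mathbb{E}\Big(\sum_{j\in V_2}\big(\bar d-d_B(j)\big)^2\Big)\le i(k-i),$$ where $d_B(j)$ is the degree of $j$ in $B$. -}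

module Defs where

open import Data.Bool using (Bool; true; false; if_then_else_)
open import Data.Nat as ℕ using (ℕ; zero; suc; _≡ᵇ_)
open import Data.Integer as ℤ using (ℤ; +_)
open import Data.Rational as ℚ using (ℚ; _/_)
open import Data.List as List using (List; []; _∷_; map; concatMap; filterᵇ; length)
open import Data.Bool.ListAction using (and)
open import Data.Vec as Vec using (Vec; []; _∷_; lookup; toList; zipWith)
open import Data.Fin using (Fin)

allVecs : {A : Set} → List A → (n : ℕ) → List (Vec A n)
allVecs xs zero    = [] ∷ []
allVecs xs (suc n) = concatMap (λ x → map (x ∷_) (allVecs xs n)) xs

-- A bipartite graph with parts V₁ = Fin i (vertices 1..i) and
-- V₂ = Fin m (vertex l ∈ Fin m stands for vertex i+1+l), given by its
-- biadjacency matrix: row j lists the neighbours of j ∈ V₁ in V₂.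
BipGraph : ℕ → ℕ → Set
BipGraph i m = Vec (Vec Bool m) i

allBipGraphs : (i m : ℕ) → List (BipGraph i m)
allBipGraphs i m = allVecs (allVecs (true ∷ false ∷ []) m) i

countTrue : {n : ℕ} → Vec Bool n → ℕ
countTrue []            = 0
countTrue (true  ∷ bs)  = suc (countTrue bs)
countTrue (false ∷ bs)  = countTrue bs

deg₁ : {i m : ℕ} → BipGraph i m → Fin i → ℕ
deg₁ B j = countTrue (lookup B j)

deg₂ : {i m : ℕ} → BipGraph i m → Fin m → ℕ
deg₂ B l = countTrue (Vec.map (λ row → lookup row l) B)

-- B ∈ 𝓑(d*): every j ∈ V₁ has degree d - d_j  (stated as d_j + deg j = d,
-- so that it is the integer equation deg j = d - d_j, no truncation).
inBᵇ : {i m : ℕ} → (d : ℕ) → Vec ℕ i → BipGraph i m → Bool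
inBᵇ d ds B = and (toList (zipWith (λ dj row → (dj ℕ.+ countTrue row) ≡ᵇ d) ds B))

-- The finite set 𝓑(d*) as a list (without repetitions).
Bset : {i : ℕ} → (m d : ℕ) → Vec ℕ i → List (BipGraph i m)
Bset {i} m d ds = filterᵇ (inBᵇ d ds) (allBipGraphs i m)

sumℚ : List ℚ → ℚ
sumℚ = List.foldr ℚ._+_ ℚ.0ℚ

-- z / m as a rational (m = 0 never occurs in the statement since i < k).
divℕ : ℤ → ℕ → ℚ
divℕ z zero    = ℚ.0ℚ
divℕ z (suc n) = z / suc n

mean : List ℚ → ℚ
mean xs = sumℚ xs ℚ.* divℕ (+ 1) (length xs)

dbar : {i : ℕ} → (m d : ℕ) → Vec ℕ i → ℚ
dbar m d ds = divℕ (List.foldr ℤ._+_ ℤ.0ℤ (toList (Vec.map (λ dj → + d ℤ.- + dj) ds))) m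

devSq : {i m : ℕ} → ℚ → BipGraph i m → ℚ
devSq {m = m} db B =
  sumℚ (toList (Vec.map (λ l → let x = db ℚ.- (+ deg₂ B l / 1) in x ℚ.* x) (Vec.allFin m)))

-- A graph in 𝓑(d*) is an independent choice, for every j ∈ V₁, of a row of length
-- m = k - i with a_j = d - d_j true entries. Prepending a row r to a graph changes
-- Σ_l deg(l)² by |r| + 2 Σ_l r_l deg(l), and each column is true in exactly a c / m
-- of the c rows of size a. Summing over 𝓑, with N graphs,
-- S = Σ_B Σ_l deg_B(l)² and D = Σ_j a_j, this yields the recurrence
--   m S' = c N a m + 2 a c N D + c m S,
-- and a m ≤ m² + a² gives m S ≤ N (i m² + D²) by induction on i. Since every graph
-- has Σ_l deg(l) = D = m d̄, we have Σ_l (d̄ - deg l)² = Σ_l deg(l)² - D²/m, so the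
-- mean is S/N - D²/m ≤ i m.

module Submission where

open import Defs
open import Data.Bool using (Bool; true; false; T; _∧_)
open import Data.Bool.Properties using (T-∧)
open import Data.Nat using (ℕ; zero; suc; _+_; _*_; _∸_; _≤_; _<_; _≡ᵇ_; z≤n; s≤s; NonZero; >-nonZero)
open import Data.Nat.Divisibility using (_∣_)
import Data.Nat.Properties as ℕ
open import Data.Nat.Solver using (module +-*-Solver)
open import Algebra.Properties.CommutativeSemigroup ℕ.+-commutativeSemigroup using () renaming (interchange to +-interchange)
open import Data.Fin using (Fin; zero; suc)
open import Data.List using (List; []; _∷_; _++_; map; concatMap; filterᵇ; length; foldr)
import Data.List.Properties as List
open import Data.List.Relation.Unary.All as All using (All; []; _∷_)
open import Data.List.Relation.Unary.All.Properties using (all-filter)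
open import Data.Vec as Vec using (Vec; []; _∷_; lookup; toList; sum)
import Data.Vec.Properties as Vec
open import Data.Product using (_×_; _,_)
open import Data.Sum using (inj₁; inj₂)
open import Function using (_∘_; Equivalence)
open import Relation.Nullary using (yes; no; contradiction)
open import Relation.Nullary.Decidable using (T?)
open import Relation.Binary.PropositionalEquality

private variable
  A B : Set
  n : ℕ

-- Finite sums

∑ : List A → (A → ℕ) → ℕ
∑ []       f = 0
∑ (x ∷ xs) f = f x + ∑ xs f

module _ {f g : A → ℕ} where

  ∑-cong-All : {xs : List A} → All (λ x → f x ≡ g x) xs → ∑ xs f ≡ ∑ xs g
  ∑-cong-All []         = refl
  ∑-cong-All (fx≡gx ∷ eqs) = cong₂ _+_ fx≡gx (∑-cong-All eqs)

  ∑-cong : (xs : List A) → (∀ x → f x ≡ g x) → ∑ xs f ≡ ∑ xs g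
  ∑-cong xs f≗g = ∑-cong-All (All.universal f≗g xs)

  ∑-distrib-+ : (xs : List A) → ∑ xs (λ x → f x + g x) ≡ ∑ xs f + ∑ xs g
  ∑-distrib-+ []       = refl
  ∑-distrib-+ (x ∷ xs) = trans (cong ((f x + g x) +_) (∑-distrib-+ xs)) (+-interchange (f x) (g x) _ _)

∑-distribˡ-* : (c : ℕ) (xs : List A) (f : A → ℕ) → ∑ xs (λ x → c * f x) ≡ c * ∑ xs f
∑-distribˡ-* c []       f = sym (ℕ.*-zeroʳ c)
∑-distribˡ-* c (x ∷ xs) f = trans (cong (c * f x +_) (∑-distribˡ-* c xs f)) (sym (ℕ.*-distribˡ-+ c (f x) _))

∑-distribʳ-* : (c : ℕ) (xs : List A) (f : A → ℕ) → ∑ xs (λ x → f x * c) ≡ ∑ xs f * c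
∑-distribʳ-* c xs f = trans (∑-cong xs (λ x → ℕ.*-comm (f x) c)) (trans (∑-distribˡ-* c xs f) (ℕ.*-comm c _))

∑-const : (xs : List A) (c : ℕ) → ∑ xs (λ _ → c) ≡ length xs * c
∑-const []       c = refl
∑-const (x ∷ xs) c = cong (c +_) (∑-const xs c)

∑-zero : (xs : List A) → ∑ xs (λ _ → 0) ≡ 0
∑-zero xs = trans (∑-const xs 0) (ℕ.*-zeroʳ (length xs))

∑-++ : (xs ys : List A) (f : A → ℕ) → ∑ (xs ++ ys) f ≡ ∑ xs f + ∑ ys f
∑-++ []       ys f = refl
∑-++ (x ∷ xs) ys f = trans (cong (f x +_) (∑-++ xs ys f)) (sym (ℕ.+-assoc (f x) _ _))

∑-map : (g : A → B) (xs : List A) (f : B → ℕ) → ∑ (map g xs) f ≡ ∑ xs (f ∘ g)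
∑-map g []       f = refl
∑-map g (x ∷ xs) f = cong (f (g x) +_) (∑-map g xs f)

∑-concatMap : (g : A → List B) (xs : List A) (f : B → ℕ) → ∑ (concatMap g xs) f ≡ ∑ xs (λ x → ∑ (g x) f)
∑-concatMap g []       f = refl
∑-concatMap g (x ∷ xs) f = trans (∑-++ (g x) (concatMap g xs) f) (cong (∑ (g x) f +_) (∑-concatMap g xs f))

∑-comm : (xs : List A) (ys : List B) (f : A → B → ℕ) →
         ∑ xs (λ x → ∑ ys (f x)) ≡ ∑ ys (λ y → ∑ xs (λ x → f x y))
∑-comm []       ys f = sym (∑-zero ys)
∑-comm (x ∷ xs) ys f =
  trans (cong (∑ ys (f x) +_) (∑-comm xs ys f)) (sym (∑-distrib-+ ys))

length-∑ : (xs : List A) → length xs ≡ ∑ xs (λ _ → 1)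
length-∑ xs = trans (sym (ℕ.*-identityʳ (length xs))) (sym (∑-const xs 1))

filterᵇ-cong : {p q : A → Bool} → (∀ x → p x ≡ q x) → (xs : List A) → filterᵇ p xs ≡ filterᵇ q xs
filterᵇ-cong p≗q []       = refl
filterᵇ-cong {p = p} {q} p≗q (x ∷ xs) with p x | q x | p≗q x
... | true  | .true  | refl = cong (x ∷_) (filterᵇ-cong p≗q xs)
... | false | .false | refl = filterᵇ-cong p≗q xs

filterᵇ-reject : (xs : List A) → filterᵇ (λ _ → false) xs ≡ []
filterᵇ-reject []       = refl
filterᵇ-reject (x ∷ xs) = filterᵇ-reject xs

filterᵇ-map : (p : B → Bool) (g : A → B) (xs : List A) → filterᵇ p (map g xs) ≡ map g (filterᵇ (p ∘ g) xs)
filterᵇ-map p g []       = refl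
filterᵇ-map p g (x ∷ xs) with p (g x)
... | true  = cong (g x ∷_) (filterᵇ-map p g xs)
... | false = filterᵇ-map p g xs

filterᵇ-++ : (p : A → Bool) (xs ys : List A) → filterᵇ p (xs ++ ys) ≡ filterᵇ p xs ++ filterᵇ p ys
filterᵇ-++ p = List.filter-++ (T? ∘ p)

-- allVecs xs (suc n) unfolds to xs ⊗ allVecs xs n.
_⊗_ : List A → List (Vec A n) → List (Vec A (suc n))
xs ⊗ vs = concatMap (λ x → map (x ∷_) vs) xs

length-⊗ : (xs : List A) (vs : List (Vec A n)) → length (xs ⊗ vs) ≡ length xs * length vs
length-⊗ xs vs = begin
  length (xs ⊗ vs)                         ≡⟨ length-∑ (xs ⊗ vs) ⟩
  ∑ (xs ⊗ vs) (λ _ → 1)                    ≡⟨ ∑-concatMap _ xs _ ⟩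
  ∑ xs (λ x → ∑ (map (x ∷_) vs) (λ _ → 1)) ≡⟨ ∑-cong xs (λ x → trans (∑-map (x ∷_) vs _) (sym (length-∑ vs))) ⟩
  ∑ xs (λ _ → length vs)                   ≡⟨ ∑-const xs (length vs) ⟩
  length xs * length vs                    ∎
  where open ≡-Reasoning

∑-⊗ : (xs : List A) (vs : List (Vec A n)) (f : Vec A (suc n) → ℕ) →
      ∑ (xs ⊗ vs) f ≡ ∑ xs (λ x → ∑ vs (λ v → f (x ∷ v)))
∑-⊗ xs vs f = trans (∑-concatMap _ xs f) (∑-cong xs (λ x → ∑-map (x ∷_) vs f))

filterᵇ-⊗ : (P : Vec A (suc n) → Bool) (p : A → Bool) (q : Vec A n → Bool) →
            (∀ x v → P (x ∷ v) ≡ p x ∧ q v) →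
            (xs : List A) (vs : List (Vec A n)) → filterᵇ P (xs ⊗ vs) ≡ filterᵇ p xs ⊗ filterᵇ q vs
filterᵇ-⊗ P p q P-∷ []       vs = refl
filterᵇ-⊗ P p q P-∷ (x ∷ xs) vs = begin
  filterᵇ P (map (x ∷_) vs ++ xs ⊗ vs)
    ≡⟨ filterᵇ-++ P (map (x ∷_) vs) (xs ⊗ vs) ⟩
  filterᵇ P (map (x ∷_) vs) ++ filterᵇ P (xs ⊗ vs)
    ≡⟨ cong₂ _++_ (trans (filterᵇ-map P (x ∷_) vs) (cong (map (x ∷_)) (filterᵇ-cong (P-∷ x) vs)))
                  (filterᵇ-⊗ P p q P-∷ xs vs) ⟩
  map (x ∷_) (filterᵇ (λ v → p x ∧ q v) vs) ++ filterᵇ p xs ⊗ filterᵇ q vs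
    ≡⟨ first-block (p x) refl ⟩
  filterᵇ p (x ∷ xs) ⊗ filterᵇ q vs ∎
  where
  open ≡-Reasoning
  first-block : ∀ b → p x ≡ b →
    map (x ∷_) (filterᵇ (λ v → b ∧ q v) vs) ++ filterᵇ p xs ⊗ filterᵇ q vs ≡ filterᵇ p (x ∷ xs) ⊗ filterᵇ q vs
  first-block true  px≡b rewrite px≡b = refl
  first-block false px≡b rewrite px≡b | filterᵇ-reject vs = refl

-- Rows of a given size

bit : Bool → ℕ
bit true  = 1
bit false = 0

countTrue-∷ : (b : Bool) (bs : Vec Bool n) → countTrue (b ∷ bs) ≡ bit b + countTrue bs
countTrue-∷ true  bs = refl
countTrue-∷ false bs = refl

rows : (m : ℕ) → List (Vec Bool m)
rows m = allVecs (true ∷ false ∷ []) m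

rows-suc : (m : ℕ) → rows (suc m) ≡ map (true ∷_) (rows m) ++ map (false ∷_) (rows m)
rows-suc m = cong (map (true ∷_) (rows m) ++_) (List.++-identityʳ (map (false ∷_) (rows m)))

rowsOfSize : (m a : ℕ) → List (Vec Bool m)
rowsOfSize m a = filterᵇ (λ r → countTrue r ≡ᵇ a) (rows m)

-- The tails of the rows of size a that start with true (so none when a = 0).
rowsOfSizePred : (m a : ℕ) → List (Vec Bool m)
rowsOfSizePred m zero    = []
rowsOfSizePred m (suc a) = rowsOfSize m a

rowsOfSize-suc : (m a : ℕ) →
  rowsOfSize (suc m) a ≡ map (true ∷_) (rowsOfSizePred m a) ++ map (false ∷_) (rowsOfSize m a)
rowsOfSize-suc m a = begin
  filterᵇ size≡a (rows (suc m))
    ≡⟨ cong (filterᵇ size≡a) (rows-suc m) ⟩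
  filterᵇ size≡a (map (true ∷_) (rows m) ++ map (false ∷_) (rows m))
    ≡⟨ filterᵇ-++ size≡a (map (true ∷_) (rows m)) (map (false ∷_) (rows m)) ⟩
  filterᵇ size≡a (map (true ∷_) (rows m)) ++ filterᵇ size≡a (map (false ∷_) (rows m))
    ≡⟨ cong₂ _++_ (trans (filterᵇ-map size≡a (true ∷_) (rows m)) (cong (map (true ∷_)) (true-tails a)))
                  (filterᵇ-map size≡a (false ∷_) (rows m)) ⟩
  map (true ∷_) (rowsOfSizePred m a) ++ map (false ∷_) (rowsOfSize m a) ∎
  where
  open ≡-Reasoning
  size≡a : Vec Bool (suc m) → Bool
  size≡a r = countTrue r ≡ᵇ a
  true-tails : ∀ a → filterᵇ (λ r → suc (countTrue r) ≡ᵇ a) (rows m) ≡ rowsOfSizePred m a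
  true-tails zero    = filterᵇ-reject (rows m)
  true-tails (suc a) = refl

count : (m a : ℕ) → ℕ
count m a = length (rowsOfSize m a)

count-suc : (m a : ℕ) → count (suc m) a ≡ length (rowsOfSizePred m a) + count m a
count-suc m a = begin
  length (rowsOfSize (suc m) a)
    ≡⟨ cong length (rowsOfSize-suc m a) ⟩
  length (map (true ∷_) (rowsOfSizePred m a) ++ map (false ∷_) (rowsOfSize m a))
    ≡⟨ List.length-++ (map (true ∷_) (rowsOfSizePred m a)) ⟩
  length (map (true ∷_) (rowsOfSizePred m a)) + length (map (false ∷_) (rowsOfSize m a))
    ≡⟨ cong₂ _+_ (List.length-map (true ∷_) (rowsOfSizePred m a)) (List.length-map (false ∷_) (rowsOfSize m a)) ⟩
  length (rowsOfSizePred m a) + count m a ∎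
  where open ≡-Reasoning

∑-rowsOfSize-suc : (m a : ℕ) (f : Vec Bool (suc m) → ℕ) →
  ∑ (rowsOfSize (suc m) a) f ≡ ∑ (rowsOfSizePred m a) (f ∘ (true ∷_)) + ∑ (rowsOfSize m a) (f ∘ (false ∷_))
∑-rowsOfSize-suc m a f = begin
  ∑ (rowsOfSize (suc m) a) f
    ≡⟨ cong (λ rs → ∑ rs f) (rowsOfSize-suc m a) ⟩
  ∑ (map (true ∷_) (rowsOfSizePred m a) ++ map (false ∷_) (rowsOfSize m a)) f
    ≡⟨ ∑-++ (map (true ∷_) (rowsOfSizePred m a)) (map (false ∷_) (rowsOfSize m a)) f ⟩
  ∑ (map (true ∷_) (rowsOfSizePred m a)) f + ∑ (map (false ∷_) (rowsOfSize m a)) f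
    ≡⟨ cong₂ _+_ (∑-map (true ∷_) (rowsOfSizePred m a) f) (∑-map (false ∷_) (rowsOfSize m a) f) ⟩
  ∑ (rowsOfSizePred m a) (f ∘ (true ∷_)) + ∑ (rowsOfSize m a) (f ∘ (false ∷_)) ∎
  where open ≡-Reasoning

column-rowsOfSize : (m a : ℕ) (l : Fin (suc m)) →
  ∑ (rowsOfSize (suc m) a) (λ r → bit (lookup r l)) ≡ length (rowsOfSizePred m a)
column-rowsOfSize m a zero = begin
  ∑ (rowsOfSize (suc m) a) (λ r → bit (lookup r zero))
    ≡⟨ ∑-rowsOfSize-suc m a _ ⟩
  ∑ (rowsOfSizePred m a) (λ _ → 1) + ∑ (rowsOfSize m a) (λ _ → 0)
    ≡⟨ cong₂ _+_ (sym (length-∑ (rowsOfSizePred m a))) (∑-zero (rowsOfSize m a)) ⟩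
  length (rowsOfSizePred m a) + 0
    ≡⟨ ℕ.+-identityʳ _ ⟩
  length (rowsOfSizePred m a) ∎
  where open ≡-Reasoning
column-rowsOfSize (suc m) a (suc l) =
  trans (∑-rowsOfSize-suc (suc m) a _) (pascal a)
  where
  column : Vec Bool (suc m) → ℕ
  column r = bit (lookup r l)
  pascal : ∀ a → ∑ (rowsOfSizePred (suc m) a) column + ∑ (rowsOfSize (suc m) a) column
                 ≡ length (rowsOfSizePred (suc m) a)
  pascal zero    = column-rowsOfSize m zero l
  pascal (suc a) = trans (cong₂ _+_ (column-rowsOfSize m a l) (column-rowsOfSize m (suc a) l))
                         (sym (count-suc m a))

∑-rowsOfSize-countTrue : (m a : ℕ) → ∑ (rowsOfSize m a) countTrue ≡ a * count m a
∑-rowsOfSize-countTrue m a = begin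
  ∑ (rowsOfSize m a) countTrue
    ≡⟨ ∑-cong-All (All.map (λ {r} → ℕ.≡ᵇ⇒≡ (countTrue r) a) (all-filter (T? ∘ (λ r → countTrue r ≡ᵇ a)) (rows m))) ⟩
  ∑ (rowsOfSize m a) (λ _ → a)
    ≡⟨ ∑-const (rowsOfSize m a) a ⟩
  count m a * a
    ≡⟨ ℕ.*-comm (count m a) a ⟩
  a * count m a ∎
  where open ≡-Reasoning

columns : (m : ℕ) → List (Fin m)
columns m = toList (Vec.allFin m)

length-columns : (m : ℕ) → length (columns m) ≡ m
length-columns m = Vec.length-toList (Vec.allFin m)

∑-columns-suc : (m : ℕ) (f : Fin (suc m) → ℕ) → ∑ (columns (suc m)) f ≡ f zero + ∑ (columns m) (f ∘ suc)
∑-columns-suc m f = cong (f zero +_) (begin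
  ∑ (toList (Vec.tabulate suc)) f        ≡⟨ cong (λ v → ∑ (toList v) f) (Vec.tabulate-allFin suc) ⟩
  ∑ (toList (Vec.map suc (Vec.allFin m))) f ≡⟨ cong (λ xs → ∑ xs f) (Vec.toList-map suc (Vec.allFin m)) ⟩
  ∑ (map suc (columns m)) f              ≡⟨ ∑-map suc (columns m) f ⟩
  ∑ (columns m) (f ∘ suc)                ∎)
  where open ≡-Reasoning

∑-columns-bit : (r : Vec Bool n) → ∑ (columns n) (λ l → bit (lookup r l)) ≡ countTrue r
∑-columns-bit []      = refl
∑-columns-bit (b ∷ r) =
  trans (∑-columns-suc _ (λ l → bit (lookup (b ∷ r) l)))
        (trans (cong (bit b +_) (∑-columns-bit r)) (sym (countTrue-∷ b r)))

-- Double counting the true entries of the rows of size a, each column holding the same number of them.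
column-balance : (m a : ℕ) (l : Fin m) → m * ∑ (rowsOfSize m a) (λ r → bit (lookup r l)) ≡ a * count m a
column-balance (suc m) a l = begin
  suc m * ∑ (rowsOfSize (suc m) a) (column l)
    ≡⟨ cong (suc m *_) (column-rowsOfSize m a l) ⟩
  suc m * K
    ≡⟨ cong (_* K) (sym (length-columns (suc m))) ⟩
  length (columns (suc m)) * K
    ≡⟨ sym (∑-const (columns (suc m)) K) ⟩
  ∑ (columns (suc m)) (λ _ → K)
    ≡⟨ ∑-cong (columns (suc m)) (λ l → sym (column-rowsOfSize m a l)) ⟩
  ∑ (columns (suc m)) (λ l → ∑ (rowsOfSize (suc m) a) (column l))
    ≡⟨ ∑-comm (columns (suc m)) (rowsOfSize (suc m) a) (λ l r → bit (lookup r l)) ⟩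
  ∑ (rowsOfSize (suc m) a) (λ r → ∑ (columns (suc m)) (λ l → bit (lookup r l)))
    ≡⟨ ∑-cong (rowsOfSize (suc m) a) ∑-columns-bit ⟩
  ∑ (rowsOfSize (suc m) a) countTrue
    ≡⟨ ∑-rowsOfSize-countTrue (suc m) a ⟩
  a * count (suc m) a ∎
  where
  open ≡-Reasoning
  K = length (rowsOfSizePred m a)
  column : Fin (suc m) → Vec Bool (suc m) → ℕ
  column l r = bit (lookup r l)

-- Degrees of the graphs in 𝓑(d*)

deg₂-∷ : {i m : ℕ} (r : Vec Bool m) (B : BipGraph i m) (l : Fin m) → deg₂ (r ∷ B) l ≡ bit (lookup r l) + deg₂ B l
deg₂-∷ r B l = countTrue-∷ (lookup r l) _

∑-deg₂ : {i m : ℕ} (B : BipGraph i m) → ∑ (columns m) (deg₂ B) ≡ Vec.sum (Vec.map countTrue B)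
∑-deg₂ {m = m} []      = ∑-zero (columns m)
∑-deg₂ {m = m} (r ∷ B) = begin
  ∑ (columns m) (deg₂ (r ∷ B))
    ≡⟨ ∑-cong (columns m) (deg₂-∷ r B) ⟩
  ∑ (columns m) (λ l → bit (lookup r l) + deg₂ B l)
    ≡⟨ ∑-distrib-+ (columns m) ⟩
  ∑ (columns m) (λ l → bit (lookup r l)) + ∑ (columns m) (deg₂ B)
    ≡⟨ cong₂ _+_ (∑-columns-bit r) (∑-deg₂ B) ⟩
  countTrue r + Vec.sum (Vec.map countTrue B) ∎
  where open ≡-Reasoning

degreeSum : {i : ℕ} → ℕ → Vec ℕ i → ℕ
degreeSum d ds = Vec.sum (Vec.map (d ∸_) ds)

inBᵇ-∷ : {i m d : ℕ} (d₀ : ℕ) (ds : Vec ℕ i) (r : Vec Bool m) (B : BipGraph i m) →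
         T (inBᵇ d (d₀ ∷ ds) (r ∷ B)) → d₀ + countTrue r ≡ d × T (inBᵇ d ds B)
inBᵇ-∷ {d = d} d₀ ds r B inB with Equivalence.to T-∧ inB
... | row , rest = ℕ.≡ᵇ⇒≡ (d₀ + countTrue r) d row , rest

rowSums-inBᵇ : {i m d : ℕ} (ds : Vec ℕ i) (B : BipGraph i m) →
               T (inBᵇ d ds B) → Vec.sum (Vec.map countTrue B) ≡ degreeSum d ds
rowSums-inBᵇ []        []      _   = refl
rowSums-inBᵇ {d = d} (d₀ ∷ ds) (r ∷ B) inB with inBᵇ-∷ d₀ ds r B inB
... | row , rest = cong₂ _+_ (trans (sym (ℕ.m+n∸m≡n d₀ (countTrue r))) (cong (_∸ d₀) row))
                             (rowSums-inBᵇ ds B rest)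

∑-deg₂-inBᵇ : {i m d : ℕ} (ds : Vec ℕ i) (B : BipGraph i m) →
              T (inBᵇ d ds B) → ∑ (columns m) (deg₂ B) ≡ degreeSum d ds
∑-deg₂-inBᵇ ds B inB = trans (∑-deg₂ B) (rowSums-inBᵇ ds B inB)

+-≡ᵇ-≤ : {d₀ d : ℕ} → d₀ ≤ d → (x : ℕ) → (d₀ + x ≡ᵇ d) ≡ (x ≡ᵇ d ∸ d₀)
+-≡ᵇ-≤ z≤n     x = refl
+-≡ᵇ-≤ (s≤s p) x = +-≡ᵇ-≤ p x

+-≡ᵇ-> : {d₀ d : ℕ} → d < d₀ → (x : ℕ) → (d₀ + x ≡ᵇ d) ≡ false
+-≡ᵇ-> {d = zero}  (s≤s _) x = refl
+-≡ᵇ-> {d = suc d} (s≤s p) x = +-≡ᵇ-> p x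

Bset-∷ : {i : ℕ} (m d d₀ : ℕ) (ds : Vec ℕ i) →
         Bset m d (d₀ ∷ ds) ≡ filterᵇ (λ r → d₀ + countTrue r ≡ᵇ d) (rows m) ⊗ Bset m d ds
Bset-∷ {i} m d d₀ ds = filterᵇ-⊗ (inBᵇ d (d₀ ∷ ds)) _ (inBᵇ d ds) (λ _ _ → refl) (rows m) (allBipGraphs i m)

Bset-∷-≤ : {i : ℕ} (m : ℕ) {d d₀ : ℕ} (ds : Vec ℕ i) → d₀ ≤ d →
           Bset m d (d₀ ∷ ds) ≡ rowsOfSize m (d ∸ d₀) ⊗ Bset m d ds
Bset-∷-≤ m {d} {d₀} ds d₀≤d =
  trans (Bset-∷ m d d₀ ds) (cong (_⊗ Bset m d ds) (filterᵇ-cong (λ r → +-≡ᵇ-≤ d₀≤d (countTrue r)) (rows m)))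

Bset-∷-> : {i : ℕ} (m : ℕ) {d d₀ : ℕ} (ds : Vec ℕ i) → d < d₀ → Bset m d (d₀ ∷ ds) ≡ []
Bset-∷-> m {d} {d₀} ds d<d₀ =
  trans (Bset-∷ m d d₀ ds) (cong (_⊗ Bset m d ds)
    (trans (filterᵇ-cong (λ r → +-≡ᵇ-> d<d₀ (countTrue r)) (rows m)) (filterᵇ-reject (rows m))))

All-inBᵇ-Bset : {i : ℕ} (m d : ℕ) (ds : Vec ℕ i) → All (T ∘ inBᵇ d ds) (Bset m d ds)
All-inBᵇ-Bset {i} m d ds = all-filter (T? ∘ inBᵇ d ds) (allBipGraphs i m)

-- The second moment of the degrees in V₂

degSq : {i m : ℕ} → BipGraph i m → ℕ
degSq {m = m} B = ∑ (columns m) (λ l → deg₂ B l * deg₂ B l)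

cross : {i m : ℕ} → Vec Bool m → BipGraph i m → ℕ
cross {m = m} r B = ∑ (columns m) (λ l → bit (lookup r l) * deg₂ B l)

bit-+-square : (b : Bool) (x : ℕ) → (bit b + x) * (bit b + x) ≡ bit b + 2 * (bit b * x) + x * x
bit-+-square true  x = solve 1 (λ x → (con 1 :+ x) :* (con 1 :+ x) := con 1 :+ con 2 :* (con 1 :* x) :+ x :* x) refl x
  where open +-*-Solver
bit-+-square false x = refl

degSq-∷ : {i m : ℕ} (r : Vec Bool m) (B : BipGraph i m) → degSq (r ∷ B) ≡ countTrue r + 2 * cross r B + degSq B
degSq-∷ {m = m} r B = begin
  ∑ (columns m) (λ l → deg₂ (r ∷ B) l * deg₂ (r ∷ B) l)
    ≡⟨ ∑-cong (columns m) (λ l → trans (cong (λ x → x * x) (deg₂-∷ r B l)) (bit-+-square (lookup r l) (deg₂ B l))) ⟩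
  ∑ (columns m) (λ l → bit (lookup r l) + 2 * (bit (lookup r l) * deg₂ B l) + deg₂ B l * deg₂ B l)
    ≡⟨ trans (∑-distrib-+ (columns m)) (cong (_+ degSq B) (∑-distrib-+ (columns m))) ⟩
  ∑ (columns m) (λ l → bit (lookup r l)) + ∑ (columns m) (λ l → 2 * (bit (lookup r l) * deg₂ B l)) + degSq B
    ≡⟨ cong (_+ degSq B) (cong₂ _+_ (∑-columns-bit r) (∑-distribˡ-* 2 (columns m) _)) ⟩
  countTrue r + 2 * cross r B + degSq B ∎
  where open ≡-Reasoning

degSq-⊗ : {i m : ℕ} (Rs : List (Vec Bool m)) (Bs : List (BipGraph i m)) →
  ∑ (Rs ⊗ Bs) degSq ≡ length Bs * ∑ Rs countTrue + 2 * ∑ Rs (λ r → ∑ Bs (cross r)) + length Rs * ∑ Bs degSq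
degSq-⊗ Rs Bs = begin
  ∑ (Rs ⊗ Bs) degSq
    ≡⟨ ∑-⊗ Rs Bs degSq ⟩
  ∑ Rs (λ r → ∑ Bs (λ B → degSq (r ∷ B)))
    ≡⟨ ∑-cong Rs (λ r → trans (∑-cong Bs (degSq-∷ r)) (split r)) ⟩
  ∑ Rs (λ r → length Bs * countTrue r + 2 * ∑ Bs (cross r) + ∑ Bs degSq)
    ≡⟨ trans (∑-distrib-+ Rs) (cong₂ _+_ (∑-distrib-+ Rs) (∑-const Rs (∑ Bs degSq))) ⟩
  ∑ Rs (λ r → length Bs * countTrue r) + ∑ Rs (λ r → 2 * ∑ Bs (cross r)) + length Rs * ∑ Bs degSq
    ≡⟨ cong (_+ length Rs * ∑ Bs degSq) (cong₂ _+_ (∑-distribˡ-* (length Bs) Rs countTrue) (∑-distribˡ-* 2 Rs _)) ⟩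
  length Bs * ∑ Rs countTrue + 2 * ∑ Rs (λ r → ∑ Bs (cross r)) + length Rs * ∑ Bs degSq ∎
  where
  open ≡-Reasoning
  split : ∀ r → ∑ Bs (λ B → countTrue r + 2 * cross r B + degSq B)
              ≡ length Bs * countTrue r + 2 * ∑ Bs (cross r) + ∑ Bs degSq
  split r = trans (∑-distrib-+ Bs) (cong (_+ ∑ Bs degSq)
    (trans (∑-distrib-+ Bs) (cong₂ _+_ (∑-const Bs (countTrue r)) (∑-distribˡ-* 2 Bs (cross r)))))

∑-cross : {i : ℕ} (m a : ℕ) (Bs : List (BipGraph i m)) →
  m * ∑ (rowsOfSize m a) (λ r → ∑ Bs (cross r)) ≡ a * count m a * ∑ Bs (λ B → ∑ (columns m) (deg₂ B))
∑-cross m a Bs = begin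
  m * ∑ R (λ r → ∑ Bs (λ B → ∑ (columns m) (λ l → bit (lookup r l) * deg₂ B l)))
    ≡⟨ cong (m *_) (∑-cong R (λ r → ∑-comm Bs (columns m) (λ B l → bit (lookup r l) * deg₂ B l))) ⟩
  m * ∑ R (λ r → ∑ (columns m) (λ l → ∑ Bs (λ B → bit (lookup r l) * deg₂ B l)))
    ≡⟨ cong (m *_) (∑-cong R (λ r → ∑-cong (columns m) (λ l → ∑-distribˡ-* (bit (lookup r l)) Bs (λ B → deg₂ B l)))) ⟩
  m * ∑ R (λ r → ∑ (columns m) (λ l → bit (lookup r l) * D l))
    ≡⟨ cong (m *_) (∑-comm R (columns m) (λ r l → bit (lookup r l) * D l)) ⟩
  m * ∑ (columns m) (λ l → ∑ R (λ r → bit (lookup r l) * D l))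
    ≡⟨ cong (m *_) (∑-cong (columns m) (λ l → ∑-distribʳ-* (D l) R (λ r → bit (lookup r l)))) ⟩
  m * ∑ (columns m) (λ l → ∑ R (λ r → bit (lookup r l)) * D l)
    ≡⟨ sym (∑-distribˡ-* m (columns m) _) ⟩
  ∑ (columns m) (λ l → m * (∑ R (λ r → bit (lookup r l)) * D l))
    ≡⟨ ∑-cong (columns m) (λ l → trans (sym (ℕ.*-assoc m _ (D l))) (cong (_* D l) (column-balance m a l))) ⟩
  ∑ (columns m) (λ l → a * count m a * D l)
    ≡⟨ ∑-distribˡ-* (a * count m a) (columns m) D ⟩
  a * count m a * ∑ (columns m) D
    ≡⟨ cong (a * count m a *_) (∑-comm (columns m) Bs (λ l B → deg₂ B l)) ⟩
  a * count m a * ∑ Bs (λ B → ∑ (columns m) (deg₂ B)) ∎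
  where
  open ≡-Reasoning
  R = rowsOfSize m a
  D : Fin m → ℕ
  D l = ∑ Bs (λ B → deg₂ B l)

m*n≤n*n+m*m : (m n : ℕ) → m * n ≤ n * n + m * m
m*n≤n*n+m*m m n with ℕ.≤-total m n
... | inj₁ m≤n = ℕ.≤-trans (ℕ.*-monoˡ-≤ n m≤n) (ℕ.m≤m+n (n * n) (m * m))
... | inj₂ n≤m = ℕ.≤-trans (ℕ.*-monoʳ-≤ m n≤m) (ℕ.m≤n+m (m * m) (n * n))

second-moment-step : (m i a c N T A X : ℕ) → m * T ≤ N * (i * (m * m) + A * A) → m * X ≡ a * c * (N * A) →
  m * (N * (a * c) + 2 * X + c * T) ≤ c * N * (suc i * (m * m) + (a + A) * (a + A))
second-moment-step m i a c N T A X mT≤ mX≡ = begin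
  m * (N * (a * c) + 2 * X + c * T)
    ≡⟨ solve 6 (λ m a c N T X → m :* (N :* (a :* c) :+ con 2 :* X :+ c :* T)
                  := c :* N :* (a :* m) :+ con 2 :* (m :* X) :+ c :* (m :* T)) refl m a c N T X ⟩
  c * N * (a * m) + 2 * (m * X) + c * (m * T)
    ≤⟨ ℕ.+-mono-≤ (ℕ.+-mono-≤ (ℕ.*-monoʳ-≤ (c * N) (m*n≤n*n+m*m a m)) (ℕ.≤-reflexive (cong (2 *_) mX≡)))
                  (ℕ.*-monoʳ-≤ c mT≤) ⟩
  c * N * (m * m + a * a) + 2 * (a * c * (N * A)) + c * (N * (i * (m * m) + A * A))
    ≡⟨ solve 6 (λ m i a c N A → c :* N :* (m :* m :+ a :* a) :+ con 2 :* (a :* c :* (N :* A))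
                                :+ c :* (N :* (i :* (m :* m) :+ A :* A))
                  := c :* N :* ((con 1 :+ i) :* (m :* m) :+ (a :+ A) :* (a :+ A))) refl m i a c N A ⟩
  c * N * (suc i * (m * m) + (a + A) * (a + A)) ∎
  where
  open ℕ.≤-Reasoning
  open +-*-Solver

∑-∑-deg₂-Bset : {i : ℕ} (m d : ℕ) (ds : Vec ℕ i) →
  ∑ (Bset m d ds) (λ B → ∑ (columns m) (deg₂ B)) ≡ length (Bset m d ds) * degreeSum d ds
∑-∑-deg₂-Bset m d ds =
  trans (∑-cong-All (All.map (λ {B} → ∑-deg₂-inBᵇ ds B) (All-inBᵇ-Bset m d ds))) (∑-const (Bset m d ds) (degreeSum d ds))

second-moment-≤ : {i : ℕ} (m d : ℕ) (ds : Vec ℕ i) →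
  m * ∑ (Bset m d ds) degSq ≤ length (Bset m d ds) * (i * (m * m) + degreeSum d ds * degreeSum d ds)
second-moment-≤ m d [] = ℕ.≤-reflexive (trans (cong (λ x → m * (x + 0)) (∑-zero (columns m))) (ℕ.*-zeroʳ m))
second-moment-≤ {suc i} m d (d₀ ∷ ds) with d₀ ℕ.≤? d
... | no d₀≰d rewrite Bset-∷-> m ds (ℕ.≰⇒> d₀≰d) | ℕ.*-zeroʳ m = z≤n
... | yes d₀≤d = begin
  m * ∑ (Bset m d (d₀ ∷ ds)) degSq
    ≡⟨ cong (λ Bs → m * ∑ Bs degSq) (Bset-∷-≤ m ds d₀≤d) ⟩
  m * ∑ (R ⊗ 𝓑) degSq
    ≡⟨ cong (m *_) (trans (degSq-⊗ R 𝓑) (cong (λ x → N * x + 2 * X + c * S) (∑-rowsOfSize-countTrue m a))) ⟩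
  m * (N * (a * c) + 2 * X + c * S)
    ≤⟨ second-moment-step m i a c N S D X (second-moment-≤ m d ds)
         (trans (∑-cross m a 𝓑) (cong (a * c *_) (∑-∑-deg₂-Bset m d ds))) ⟩
  c * N * (suc i * (m * m) + (a + D) * (a + D))
    ≡⟨ cong (_* (suc i * (m * m) + (a + D) * (a + D))) (sym (trans (cong length (Bset-∷-≤ m ds d₀≤d)) (length-⊗ R 𝓑))) ⟩
  length (Bset m d (d₀ ∷ ds)) * (suc i * (m * m) + (a + D) * (a + D)) ∎
  where
  open ℕ.≤-Reasoning
  a = d ∸ d₀
  R = rowsOfSize m a
  𝓑 = Bset m d ds
  c = count m a
  N = length 𝓑
  S = ∑ 𝓑 degSq
  D = degreeSum d ds
  X = ∑ R (λ r → ∑ 𝓑 (cross r))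

-- Passing to ℚ

open import Data.Integer using (+_)
import Data.Integer.Properties as ℤ
import Data.Integer as ℤ
open import Data.Rational using (ℚ; mkℚ; _/_) renaming (_≤_ to _≤ℚ_)
import Data.Rational as ℚ
import Data.Rational.Properties as ℚ
import Data.Rational.Unnormalised as ℚᵘ
import Data.Rational.Unnormalised.Properties as ℚᵘ
import Data.Nat.Coprimality as Coprime
open import Data.Rational.Solver renaming (module +-*-Solver to ℚ-Solver)
open import Algebra.Properties.AbelianGroup ℚ.+-0-abelianGroup using (xyx⁻¹≈y)

fromℕ : ℕ → ℚ
fromℕ n = + n / 1

fromℕ-normalised : (n : ℕ) → fromℕ n ≡ mkℚ (+ n) 0 (Coprime.sym (Coprime.1-coprimeTo n))
fromℕ-normalised n = ℚ.normalize-coprime (Coprime.sym (Coprime.1-coprimeTo n))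

fromℕ-+ : (m n : ℕ) → fromℕ (m + n) ≡ fromℕ m ℚ.+ fromℕ n
fromℕ-+ m n rewrite fromℕ-normalised m | fromℕ-normalised n =
  cong (_/ 1) (trans (ℤ.pos-+ m n) (sym (cong₂ ℤ._+_ (ℤ.*-identityʳ (+ m)) (ℤ.*-identityʳ (+ n)))))

fromℕ-* : (m n : ℕ) → fromℕ (m * n) ≡ fromℕ m ℚ.* fromℕ n
fromℕ-* m n rewrite fromℕ-normalised m | fromℕ-normalised n = cong (_/ 1) (ℤ.pos-* m n)

fromℕ-mono-≤ : {m n : ℕ} → m ≤ n → fromℕ m ℚ.≤ fromℕ n
fromℕ-mono-≤ {m} {n} m≤n rewrite fromℕ-normalised m | fromℕ-normalised n =
  ℚ.*≤* (subst₂ ℤ._≤_ (sym (ℤ.*-identityʳ (+ m))) (sym (ℤ.*-identityʳ (+ n))) (ℤ.+≤+ m≤n))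

fromℕ-positive : (n : ℕ) → ℚ.Positive (fromℕ (suc n))
fromℕ-positive n rewrite fromℕ-normalised (suc n) = _

/-*-fromℕ : (a n : ℕ) → (+ a / suc n) ℚ.* fromℕ (suc n) ≡ fromℕ a
/-*-fromℕ a n = ℚ.toℚᵘ-injective (begin
  ℚ.toℚᵘ ((+ a / suc n) ℚ.* fromℕ (suc n))
    ≈⟨ ℚ.toℚᵘ-homo-* (+ a / suc n) (fromℕ (suc n)) ⟩
  ℚ.toℚᵘ (+ a / suc n) ℚᵘ.* ℚ.toℚᵘ (fromℕ (suc n))
    ≈⟨ ℚᵘ.*-cong (ℚ.toℚᵘ-fromℚᵘ (ℚᵘ.mkℚᵘ (+ a) n)) (ℚ.toℚᵘ-fromℚᵘ (ℚᵘ.mkℚᵘ (+ suc n) 0)) ⟩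
  ℚᵘ.mkℚᵘ (+ a) n ℚᵘ.* ℚᵘ.mkℚᵘ (+ suc n) 0
    ≈⟨ ℚᵘ.*≡* (trans (ℤ.*-identityʳ _) (cong (λ x → + a ℤ.* + x) (sym (ℕ.*-identityʳ (suc n))))) ⟩
  ℚᵘ.mkℚᵘ (+ a) 0
    ≈⟨ ℚᵘ.≃-sym (ℚ.toℚᵘ-fromℚᵘ (ℚᵘ.mkℚᵘ (+ a) 0)) ⟩
  ℚ.toℚᵘ (fromℕ a) ∎)
  where open ℚᵘ.≃-Reasoning

sumℚ-map-minus : (xs : List A) (f : A → ℕ) (q : ℚ) →
  sumℚ (map (λ x → fromℕ (f x) ℚ.- q) xs) ≡ fromℕ (∑ xs f) ℚ.- fromℕ (length xs) ℚ.* q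
sumℚ-map-minus []       f q = solve 1 (λ q → con ℚ.0ℚ := con ℚ.0ℚ :- con ℚ.0ℚ :* q) refl q
  where open ℚ-Solver
sumℚ-map-minus (x ∷ xs) f q
  rewrite sumℚ-map-minus xs f q | fromℕ-+ (f x) (∑ xs f) | fromℕ-+ 1 (length xs) =
  solve 4 (λ y s n q → (y :- q) :+ (s :- n :* q) := (y :+ s) :- (con ℚ.1ℚ :+ n) :* q) refl
    (fromℕ (f x)) (fromℕ (∑ xs f)) (fromℕ (length xs)) q
  where open ℚ-Solver

sumℚ-squares : (q : ℚ) (xs : List A) (f : A → ℕ) →
  sumℚ (map (λ x → (q ℚ.- fromℕ (f x)) ℚ.* (q ℚ.- fromℕ (f x))) xs)
    ≡ fromℕ (∑ xs (λ x → f x * f x)) ℚ.- (q ℚ.+ q) ℚ.* fromℕ (∑ xs f) ℚ.+ fromℕ (length xs) ℚ.* (q ℚ.* q)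
sumℚ-squares q []       f = solve 1 (λ q → con ℚ.0ℚ := con ℚ.0ℚ :- (q :+ q) :* con ℚ.0ℚ :+ con ℚ.0ℚ :* (q :* q)) refl q
  where open ℚ-Solver
sumℚ-squares q (x ∷ xs) f
  rewrite sumℚ-squares q xs f | fromℕ-+ (f x * f x) (∑ xs (λ x → f x * f x)) | fromℕ-* (f x) (f x)
        | fromℕ-+ (f x) (∑ xs f) | fromℕ-+ 1 (length xs) =
  solve 5 (λ q y s₂ s₁ n → (q :- y) :* (q :- y) :+ (s₂ :- (q :+ q) :* s₁ :+ n :* (q :* q))
                        := (y :* y :+ s₂) :- (q :+ q) :* (y :+ s₁) :+ (con ℚ.1ℚ :+ n) :* (q :* q)) refl
    q (fromℕ (f x)) (fromℕ (∑ xs (λ x → f x * f x))) (fromℕ (∑ xs f)) (fromℕ (length xs))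
  where open ℚ-Solver

devSq-inBᵇ : {i m d : ℕ} (ds : Vec ℕ i) (B : BipGraph i m) (q : ℚ) → T (inBᵇ d ds B) →
  q ℚ.* fromℕ m ≡ fromℕ (degreeSum d ds) → devSq q B ≡ fromℕ (degSq B) ℚ.- q ℚ.* fromℕ (degreeSum d ds)
devSq-inBᵇ {m = m} {d} ds B q inB q*m≡D = begin
  sumℚ (toList (Vec.map dev² (Vec.allFin m)))
    ≡⟨ cong sumℚ (Vec.toList-map dev² (Vec.allFin m)) ⟩
  sumℚ (map dev² (columns m))
    ≡⟨ sumℚ-squares q (columns m) (deg₂ B) ⟩
  fromℕ (degSq B) ℚ.- (q ℚ.+ q) ℚ.* fromℕ (∑ (columns m) (deg₂ B)) ℚ.+ fromℕ (length (columns m)) ℚ.* (q ℚ.* q)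
    ≡⟨ cong₂ (λ s n → fromℕ (degSq B) ℚ.- (q ℚ.+ q) ℚ.* s ℚ.+ fromℕ n ℚ.* (q ℚ.* q))
             (trans (cong fromℕ (∑-deg₂-inBᵇ ds B inB)) (sym q*m≡D)) (length-columns m) ⟩
  fromℕ (degSq B) ℚ.- (q ℚ.+ q) ℚ.* (q ℚ.* fromℕ m) ℚ.+ fromℕ m ℚ.* (q ℚ.* q)
    ≡⟨ solve 3 (λ s q m → s :- (q :+ q) :* (q :* m) :+ m :* (q :* q) := s :- q :* (q :* m)) refl
         (fromℕ (degSq B)) q (fromℕ m) ⟩
  fromℕ (degSq B) ℚ.- q ℚ.* (q ℚ.* fromℕ m)
    ≡⟨ cong (λ x → fromℕ (degSq B) ℚ.- q ℚ.* x) q*m≡D ⟩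
  fromℕ (degSq B) ℚ.- q ℚ.* fromℕ (degreeSum d ds) ∎
  where
  open ≡-Reasoning
  open ℚ-Solver
  dev² : Fin m → ℚ
  dev² l = (q ℚ.- fromℕ (deg₂ B l)) ℚ.* (q ℚ.- fromℕ (deg₂ B l))

-- dbar subtracts in ℤ; membership of B forces every d_j ≤ d, so this agrees with the truncated degreeSum.
∑ℤ-inBᵇ : {i m d : ℕ} (ds : Vec ℕ i) (B : BipGraph i m) → T (inBᵇ d ds B) →
  foldr ℤ._+_ ℤ.0ℤ (toList (Vec.map (λ dⱼ → + d ℤ.- + dⱼ) ds)) ≡ + degreeSum d ds
∑ℤ-inBᵇ []        []      _   = refl
∑ℤ-inBᵇ {d = d} (d₀ ∷ ds) (r ∷ B) inB with inBᵇ-∷ d₀ ds r B inB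
... | row , rest = trans (cong₂ ℤ._+_ (trans (ℤ.[+m]-[+n]≡m⊖n d d₀) (ℤ.⊖-≥ d₀≤d)) (∑ℤ-inBᵇ ds B rest))
                         (sym (ℤ.pos-+ (d ∸ d₀) (degreeSum d ds)))
  where
  d₀≤d : d₀ ≤ d
  d₀≤d = subst (d₀ ≤_) row (ℕ.m≤m+n d₀ (countTrue r))

-- Multiplying through by m n > 0 reduces the claim to the hypothesis, since q m = D turns n q D m into n D².
mean-bound : (m n S D i : ℕ) (q : ℚ) → q ℚ.* fromℕ (suc m) ≡ fromℕ D →
  suc m * S ≤ suc n * (i * (suc m * suc m) + D * D) →
  (fromℕ S ℚ.- fromℕ (suc n) ℚ.* (q ℚ.* fromℕ D)) ℚ.* (+ 1 / suc n) ℚ.≤ fromℕ (i * suc m)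
mean-bound m n S D i q q*m≡D bound =
  ℚ.*-cancelˡ-≤-pos (fromℕ (M * N)) {{fromℕ-positive (n + m * N)}} (begin
    fromℕ (M * N) ℚ.* x                                         ≡⟨ scaled ⟩
    fromℕ (M * S) ℚ.- fromℕ (N * (D * D))                       ≤⟨ ℚ.+-monoˡ-≤ (ℚ.- fromℕ (N * (D * D))) (fromℕ-mono-≤ bound) ⟩
    fromℕ (N * (i * (M * M) + D * D)) ℚ.- fromℕ (N * (D * D))   ≡⟨ cancel ⟩
    fromℕ (M * N) ℚ.* fromℕ (i * M)                             ∎)
  where
  open ℚ.≤-Reasoning
  M = suc m
  N = suc n
  x = (fromℕ S ℚ.- fromℕ N ℚ.* (q ℚ.* fromℕ D)) ℚ.* (+ 1 / N)

  scaled : fromℕ (M * N) ℚ.* x ≡ fromℕ (M * S) ℚ.- fromℕ (N * (D * D))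
  scaled = begin-equality
    fromℕ (M * N) ℚ.* x
      ≡⟨ cong (ℚ._* x) (fromℕ-* M N) ⟩
    fromℕ M ℚ.* fromℕ N ℚ.* x
      ≡⟨ solve 6 (λ μ ν σ δ q u → μ :* ν :* ((σ :- ν :* (q :* δ)) :* u)
                               := (μ :* σ :- ν :* (δ :* (q :* μ))) :* (u :* ν)) refl
           (fromℕ M) (fromℕ N) (fromℕ S) (fromℕ D) q (+ 1 / N) ⟩
    (fromℕ M ℚ.* fromℕ S ℚ.- fromℕ N ℚ.* (fromℕ D ℚ.* (q ℚ.* fromℕ M))) ℚ.* ((+ 1 / N) ℚ.* fromℕ N)
      ≡⟨ cong₂ (λ y z → (fromℕ M ℚ.* fromℕ S ℚ.- fromℕ N ℚ.* (fromℕ D ℚ.* y)) ℚ.* z) q*m≡D (/-*-fromℕ 1 n) ⟩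
    (fromℕ M ℚ.* fromℕ S ℚ.- fromℕ N ℚ.* (fromℕ D ℚ.* fromℕ D)) ℚ.* ℚ.1ℚ
      ≡⟨ ℚ.*-identityʳ _ ⟩
    fromℕ M ℚ.* fromℕ S ℚ.- fromℕ N ℚ.* (fromℕ D ℚ.* fromℕ D)
      ≡⟨ cong₂ ℚ._-_ (sym (fromℕ-* M S)) (trans (cong (fromℕ N ℚ.*_) (sym (fromℕ-* D D))) (sym (fromℕ-* N (D * D)))) ⟩
    fromℕ (M * S) ℚ.- fromℕ (N * (D * D)) ∎
    where open ℚ-Solver

  cancel : fromℕ (N * (i * (M * M) + D * D)) ℚ.- fromℕ (N * (D * D)) ≡ fromℕ (M * N) ℚ.* fromℕ (i * M)
  cancel = begin-equality
    fromℕ (N * (i * (M * M) + D * D)) ℚ.- fromℕ (N * (D * D))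
      ≡⟨ cong (λ y → fromℕ y ℚ.- fromℕ (N * (D * D))) (solve 4 (λ N i M D → N :* (i :* (M :* M) :+ D :* D)
           := N :* (D :* D) :+ M :* N :* (i :* M)) refl N i M D) ⟩
    fromℕ (N * (D * D) + M * N * (i * M)) ℚ.- fromℕ (N * (D * D))
      ≡⟨ cong (ℚ._- fromℕ (N * (D * D))) (fromℕ-+ (N * (D * D)) (M * N * (i * M))) ⟩
    fromℕ (N * (D * D)) ℚ.+ fromℕ (M * N * (i * M)) ℚ.- fromℕ (N * (D * D))
      ≡⟨ xyx⁻¹≈y (fromℕ (N * (D * D))) (fromℕ (M * N * (i * M))) ⟩
    fromℕ (M * N * (i * M))
      ≡⟨ fromℕ-* (M * N) (i * M) ⟩
    fromℕ (M * N) ℚ.* fromℕ (i * M) ∎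
    where open +-*-Solver

mean-devSq-≤ : {i : ℕ} (m d : ℕ) .{{_ : NonZero m}} (ds : Vec ℕ i) → Bset m d ds ≢ [] →
  mean (map (devSq (dbar m d ds)) (Bset m d ds)) ℚ.≤ fromℕ (i * m)
mean-devSq-≤ {i} (suc m) d ds 𝓑≢[] =
  bound (Bset (suc m) d ds) (All-inBᵇ-Bset (suc m) d ds) 𝓑≢[] (second-moment-≤ (suc m) d ds)
  where
  D = degreeSum d ds
  q = dbar (suc m) d ds
  bound : (Bs : List (BipGraph i (suc m))) → All (T ∘ inBᵇ d ds) Bs → Bs ≢ [] →
          suc m * ∑ Bs degSq ≤ length Bs * (i * (suc m * suc m) + D * D) →
          mean (map (devSq q) Bs) ℚ.≤ fromℕ (i * suc m)
  bound []       _              []≢[] _      = contradiction refl []≢[]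
  bound (B ∷ Bs) inBs@(inB ∷ _) _     moment = begin
    sumℚ (map (devSq q) (B ∷ Bs)) ℚ.* (+ 1 / suc (length (map (devSq q) Bs)))
      ≡⟨ cong₂ (λ s n → s ℚ.* (+ 1 / suc n)) sum-devSq (List.length-map (devSq q) Bs) ⟩
    (fromℕ (∑ (B ∷ Bs) degSq) ℚ.- fromℕ (length (B ∷ Bs)) ℚ.* (q ℚ.* fromℕ D)) ℚ.* (+ 1 / suc (length Bs))
      ≤⟨ mean-bound m (length Bs) (∑ (B ∷ Bs) degSq) D i q q*m≡D moment ⟩
    fromℕ (i * suc m) ∎
    where
    open ℚ.≤-Reasoning
    q*m≡D : q ℚ.* fromℕ (suc m) ≡ fromℕ D
    q*m≡D = trans (cong (ℚ._* fromℕ (suc m)) (cong (_/ suc m) (∑ℤ-inBᵇ ds B inB))) (/-*-fromℕ D m)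
    sum-devSq : sumℚ (map (devSq q) (B ∷ Bs)) ≡ fromℕ (∑ (B ∷ Bs) degSq) ℚ.- fromℕ (length (B ∷ Bs)) ℚ.* (q ℚ.* fromℕ D)
    sum-devSq = trans (cong sumℚ (List.map-cong-local (All.map (λ {B′} inB′ → devSq-inBᵇ ds B′ q inB′ q*m≡D) inBs)))
                      (sumℚ-map-minus (B ∷ Bs) degSq (q ℚ.* fromℕ D))

-- The bound holds for every degree sequence; of the hypotheses only i < k, which makes V₂ nonempty, is used.
lemma7 : (k d i : ℕ) → k ≡ 2 * d + 1 → 1 ≤ i → i < k →
    (ds : Vec ℕ i) → (∀ j → lookup ds j ≤ i ∸ 1) → 2 ∣ sum ds →
    Bset (k ∸ i) d ds ≢ [] →
    mean (map (devSq (dbar (k ∸ i) d ds)) (Bset (k ∸ i) d ds))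
    ≤ℚ (+ (i * (k ∸ i)) / 1)
lemma7 k d i _ _ i<k ds _ _ = mean-devSq-≤ (k ∸ i) d {{>-nonZero (ℕ.m<n⇒0<n∸m i<k)}} ds
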